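{- The expected value of $\pi_1$ for prime parking functions $\pi\in \mathrm{PPF}_{n+1}$ (chosen uniformly at random) is \[ \mathbb{E} [\pi_1 \mid \pi \in \mathrm{PPF}_{n+1}]=\frac{1}{2}\left(n+3-\frac{n!}{n^n}\sum_{s=0}^n\frac{n^{s}}{s!}\right).\]
   Context: A (classical) parking function of length $n$ is a sequence $\pi=(\pi_1,\dots,\pi_n)$ of positive integers whose increasing rearrangement $\lambda_1\le\cdots\le\lambda_n$ satisfies $\lambda_i\le i$ for all $i$; $\mathrm{PF}_n$ denotes the set of such. A parking function $\pi$ of length $n+1$ is a prime parking function if removing any instance of 1 from $\pi$ yields a parking function of length $n$; $\mathrm{PPF}_{n+1}$ denotes the set of prime parking functions of length $n+1$, and $|\mathrm{PPF}_{n+1}|=n^n$. -}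

module Defs where

open import Data.Bool using (Bool; true; false; _∧_; if_then_else_)
open import Data.Nat using (ℕ; zero; suc; _+_; _^_; _≤ᵇ_; _≡ᵇ_; NonZero)
open import Data.Nat.Properties using (≤-decTotalOrder; m^n≢0; _!≢0)
open import Data.Nat using (_!)
open import Data.Fin using (Fin)
open import Data.List using (List; []; _∷_; length; map; upTo; concatMap; filter; removeAt; lookup; allFin; foldr)
open import Data.Nat.ListAction using (sum)
open import Data.List.Sort.Base using (SortingAlgorithm)
open import Data.List.Sort.MergeSort ≤-decTotalOrder using (mergeSort)
open import Data.Fin.Base using (toℕ)
open import Data.Integer using (+_)
open import Data.Rational using (ℚ; 0ℚ; _/_; ½) renaming (_+_ to _+ℚ_; _*_ to _*ℚ_; _-_ to _-ℚ_)
import Relation.Nullary.Decidable as Dec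
open import Relation.Binary.PropositionalEquality using (_≡_; refl)

allB : {A : Set} → (A → Bool) → List A → Bool
allB p []       = true
allB p (x ∷ xs) = p x ∧ allB p xs

sortℕ : List ℕ → List ℕ
sortℕ = SortingAlgorithm.sort mergeSort

boundedFrom : ℕ → List ℕ → Bool
boundedFrom i []       = true
boundedFrom i (x ∷ xs) = (x ≤ᵇ i) ∧ boundedFrom (suc i) xs

isPF : List ℕ → Bool
isPF π = allB (λ x → 1 ≤ᵇ x) π ∧ boundedFrom 1 (sortℕ π)

indices : (π : List ℕ) → List (Fin (length π))
indices π = allFin (length π)

isPPF : List ℕ → Bool
isPPF π = isPF π ∧ allB (λ i → if lookup π i ≡ᵇ 1 then isPF (removeAt π i) else true) (indices π)

seqs : ℕ → ℕ → List (List ℕ)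
seqs m zero    = [] ∷ []
seqs m (suc k) = concatMap (λ x → map (x ∷_) (seqs m k)) (map suc (upTo m))

-- PPF_{n+1} as an explicit finite list.  Every parking function of length
-- m has entries in {1,…,m} (since π_j ≤ λ_m ≤ m), so this enumerates the
-- whole set PPF_{n+1}, each element exactly once.
PPF : ℕ → List (List ℕ)
PPF m = filter (λ π → Dec.T? (isPPF π)) (seqs m m)
  where open import Data.Bool using (T)

first : List ℕ → ℕ
first []      = 0
first (x ∷ _) = x

-- Mean of a finite list of naturals (0 for the empty list, never used here).
mean : List ℕ → ℚ
mean []         = 0ℚ
mean l@(_ ∷ xs) = (+ sum l) / length l

expectedFirstPPF : ℕ → ℚ
expectedFirstPPF n = mean (map first (PPF (suc n)))

-- n^n is nonzero (with the convention 0^0 = 1).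
nⁿ≢0 : ∀ n → NonZero (n ^ n)
nⁿ≢0 zero    = _
nⁿ≢0 (suc n) = m^n≢0 (suc n) (suc n)

partialExp : ℕ → ℚ
partialExp n = foldr _+ℚ_ 0ℚ (map (λ s → ((+ (n ^ s)) / (s !)) {{s !≢0}}) (upTo (suc n)))

rhs : ℕ → ℚ
rhs n = ½ *ℚ ((+ (n + 3)) / 1 -ℚ (((+ (n !)) / (n ^ n)) {{nⁿ≢0 n}}) *ℚ partialExp n)

-- Deleting the entries equal to 1 and lowering the others by one splits a sequence over 1..M+1 into
-- the positions of its c ones and a sequence over 1..M, and the parking condition, with a given
-- number of cars already queuing, becomes a recursion on M.  Summing over the positions turns counts
-- into binomial convolutions ∑_c (L choose c) G c (L - c), which induction on M evaluates by
-- Abel-type identities: with a cars queuing in advance there are (a+1)(a+j+2)^j such sequences of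
-- length j+1, and their first entries add up to W with 2W + (a+1) Q_j(a+j+2) = (a+1)(a+j+2)^j (a+j+3),
-- where Q_m(Y) = m! ∑_{s ≤ m} Y^s / s!.  For prime parking functions of length n+1 the same recursion
-- gives n^n of them and 2W + Q_n(n) = (n+3) n^n; dividing by n^n gives the mean.

module Submission where

open import Defs
open import Data.Nat hiding (_/_)
open import Data.Nat.Properties
open import Algebra.Properties.CommutativeSemigroup +-commutativeSemigroup using (interchange)
open import Algebra.Properties.CommutativeSemigroup *-commutativeSemigroup using (x∙yz≈y∙xz; x∙yz≈z∙xy)
open import Data.Nat.Tactic.RingSolver using (solve-∀)
open import Data.Nat.ListAction using (sum)
open import Data.Bool using (Bool; true; false; _∧_; _∨_; if_then_else_)
open import Data.Bool.Properties using (∧-identityʳ; ∧-zeroʳ; ∨-comm; ∧-abs-∨)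
open import Data.Fin using (Fin; zero; suc)
open import Data.List using (List; []; _∷_; _++_; map; concatMap; foldr; upTo; applyUpTo; length; filter; null; lookup; removeAt; allFin; tabulate)
open import Data.List.Properties using (map-applyUpTo; map-tabulate; length-map)
open import Data.List.Relation.Binary.Permutation.Propositional as ↭ using (_↭_; ↭-sym)
open import Data.List.Relation.Binary.Permutation.Propositional.Properties using (↭-length; filter-↭; map⁺; All-resp-↭)
open import Data.List.Relation.Unary.All as All using (All; []; _∷_)
open import Data.List.Relation.Unary.All.Properties using (concat⁺; applyUpTo⁺₁) renaming (map⁺ to All-map⁺)
import Data.List.Relation.Unary.Linked as Linked
open import Data.List.Relation.Unary.Linked.Properties using (Linked⇒All)
open import Data.List.Relation.Unary.Sorted.TotalOrder ≤-totalOrder using (Sorted)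
import Data.List.Relation.Unary.Sorted.TotalOrder.Properties as Sorted
open import Data.List.Sort.Base using (SortingAlgorithm)
open import Data.List.Sort.MergeSort ≤-decTotalOrder using (mergeSort)
open import Data.Product using (_×_; _,_; proj₁)
open import Function using (id; _∘_)
open import Relation.Nullary using (contradiction)
open import Relation.Nullary.Decidable using (T?)
open import Relation.Unary.Properties using (∁?)
open import Relation.Binary.PropositionalEquality

variable
  A : Set

sumOver : (A → ℕ) → List A → ℕ
sumOver f []       = 0
sumOver f (x ∷ xs) = f x + sumOver f xs

infix 9 sumOver
syntax sumOver (λ x → e) xs = ∑[ x ← xs ] e

infixl 7 _when_

_when_ : ℕ → Bool → ℕ
n when b = if b then n else 0

when-∧ : ∀ n b c → n when (b ∧ c) ≡ n when c when b
when-∧ n true  c = refl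
when-∧ n false c = refl

0-when : ∀ b → 0 when b ≡ 0
0-when true  = refl
0-when false = refl

sumOver-cong : ∀ {f g : A → ℕ} xs → (∀ x → f x ≡ g x) → sumOver f xs ≡ sumOver g xs
sumOver-cong []       f≗g = refl
sumOver-cong (x ∷ xs) f≗g = cong₂ _+_ (f≗g x) (sumOver-cong xs f≗g)

sumOver-cong-local : ∀ {f g : A → ℕ} {xs} → All (λ x → f x ≡ g x) xs → sumOver f xs ≡ sumOver g xs
sumOver-cong-local []            = refl
sumOver-cong-local (fx≡gx ∷ f≗g) = cong₂ _+_ fx≡gx (sumOver-cong-local f≗g)

sumOver-zero : (xs : List A) → ∑[ x ← xs ] 0 ≡ 0
sumOver-zero []       = refl
sumOver-zero (x ∷ xs) = sumOver-zero xs

sumOver-distrib-+ : ∀ (f g : A → ℕ) xs → ∑[ x ← xs ] (f x + g x) ≡ sumOver f xs + sumOver g xs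
sumOver-distrib-+ f g []       = refl
sumOver-distrib-+ f g (x ∷ xs) =
  trans (cong (f x + g x +_) (sumOver-distrib-+ f g xs)) (interchange (f x) (g x) _ _)

sumOver-when : ∀ (f : A → ℕ) b xs → ∑[ x ← xs ] (f x when b) ≡ sumOver f xs when b
sumOver-when f true  xs = refl
sumOver-when f false xs = sumOver-zero xs

sumOver-++ : ∀ (f : A → ℕ) xs ys → sumOver f (xs ++ ys) ≡ sumOver f xs + sumOver f ys
sumOver-++ f []       ys = refl
sumOver-++ f (x ∷ xs) ys = trans (cong (f x +_) (sumOver-++ f xs ys)) (sym (+-assoc (f x) _ _))

sumOver-concatMap : ∀ {B : Set} (f : B → ℕ) (g : A → List B) xs →
                    sumOver f (concatMap g xs) ≡ ∑[ x ← xs ] sumOver f (g x)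
sumOver-concatMap f g []       = refl
sumOver-concatMap f g (x ∷ xs) =
  trans (sumOver-++ f (g x) _) (cong (sumOver f (g x) +_) (sumOver-concatMap f g xs))

sumOver-map : ∀ {B : Set} (f : B → ℕ) (g : A → B) xs → sumOver f (map g xs) ≡ ∑[ x ← xs ] f (g x)
sumOver-map f g []       = refl
sumOver-map f g (x ∷ xs) = cong (f (g x) +_) (sumOver-map f g xs)

sumOver-upTo-suc : ∀ (f : ℕ → ℕ) m → ∑[ j ← upTo (suc m) ] f j ≡ f 0 + ∑[ j ← upTo m ] f (suc j)
sumOver-upTo-suc f m = cong (f 0 +_) (begin
  sumOver f (applyUpTo suc m)        ≡⟨ cong (sumOver f) (sym (map-applyUpTo id suc m)) ⟩
  sumOver f (map suc (upTo m))       ≡⟨ sumOver-map f suc (upTo m) ⟩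
  ∑[ j ← upTo m ] f (suc j)          ∎)
  where open ≡-Reasoning

-- Binomial convolutions

-- ∑_{c + k = L} (L choose c) · G c k, unfolded by Pascal's rule: the first of L points is either
-- left out (k grows) or chosen (c grows).
binomialSum : (ℕ → ℕ → ℕ) → ℕ → ℕ
binomialSum G zero    = G 0 0
binomialSum G (suc L) = binomialSum (λ c k → G c (suc k)) L + binomialSum (λ c k → G (suc c) k) L

binomialSum-cong : ∀ L {G H : ℕ → ℕ → ℕ} → (∀ c k → c + k ≡ L → G c k ≡ H c k) →
                   binomialSum G L ≡ binomialSum H L
binomialSum-cong zero    G≗H = G≗H 0 0 refl
binomialSum-cong (suc L) G≗H = cong₂ _+_
  (binomialSum-cong L (λ c k c+k≡L → G≗H c (suc k) (trans (+-suc c k) (cong suc c+k≡L))))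
  (binomialSum-cong L (λ c k c+k≡L → G≗H (suc c) k (cong suc c+k≡L)))

binomialSum-ext : ∀ L {G H : ℕ → ℕ → ℕ} → (∀ c k → G c k ≡ H c k) → binomialSum G L ≡ binomialSum H L
binomialSum-ext L G≗H = binomialSum-cong L (λ c k _ → G≗H c k)

binomialSum-zero : ∀ L → binomialSum (λ _ _ → 0) L ≡ 0
binomialSum-zero zero    = refl
binomialSum-zero (suc L) = cong₂ _+_ (binomialSum-zero L) (binomialSum-zero L)

binomialSum-distrib-+ : ∀ L (G H : ℕ → ℕ → ℕ) →
                        binomialSum (λ c k → G c k + H c k) L ≡ binomialSum G L + binomialSum H L
binomialSum-distrib-+ zero    G H = refl
binomialSum-distrib-+ (suc L) G H =
  trans (cong₂ _+_ (binomialSum-distrib-+ L (λ c k → G c (suc k)) (λ c k → H c (suc k)))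
                   (binomialSum-distrib-+ L (λ c k → G (suc c) k) (λ c k → H (suc c) k)))
        (interchange (binomialSum (λ c k → G c (suc k)) L) (binomialSum (λ c k → H c (suc k)) L) _ _)

binomialSum-*ˡ : ∀ L x (G : ℕ → ℕ → ℕ) → binomialSum (λ c k → x * G c k) L ≡ x * binomialSum G L
binomialSum-*ˡ zero    x G = refl
binomialSum-*ˡ (suc L) x G =
  trans (cong₂ _+_ (binomialSum-*ˡ L x (λ c k → G c (suc k))) (binomialSum-*ˡ L x (λ c k → G (suc c) k)))
        (sym (*-distribˡ-+ x _ _))

binomialSum-sumOver : ∀ L (F : A → ℕ → ℕ → ℕ) xs →
  binomialSum (λ c k → ∑[ x ← xs ] F x c k) L ≡ ∑[ x ← xs ] binomialSum (F x) L
binomialSum-sumOver L F []       = binomialSum-zero L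
binomialSum-sumOver L F (x ∷ xs) =
  trans (binomialSum-distrib-+ L (F x) (λ c k → ∑[ y ← xs ] F y c k))
        (cong (binomialSum (F x) L +_) (binomialSum-sumOver L F xs))

binomialSum-δ : ∀ L (F : ℕ → ℕ) → binomialSum (λ c k → F k when (c ≡ᵇ 0)) L ≡ F L
binomialSum-δ zero    F = refl
binomialSum-δ (suc L) F =
  trans (cong₂ _+_ (binomialSum-δ L (F ∘ suc)) (binomialSum-zero L)) (+-identityʳ _)

binomialSum-absorb : ∀ L (F : ℕ → ℕ → ℕ) →
  binomialSum (λ c k → c * F c k) L ≡ L * binomialSum (λ c k → F (suc c) k) (L ∸ 1)
binomialSum-absorb zero          F = refl
binomialSum-absorb (suc zero)    F = refl
binomialSum-absorb (suc (suc m)) F = begin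
    binomialSum (λ c k → c * F c (suc k)) (suc m) + binomialSum (λ c k → suc c * F (suc c) k) (suc m)
  ≡⟨ cong₂ _+_ (binomialSum-absorb (suc m) (λ c k → F c (suc k)))
               (binomialSum-distrib-+ (suc m) (λ c k → F (suc c) k) (λ c k → c * F (suc c) k)) ⟩
    suc m * U + (V + binomialSum (λ c k → c * F (suc c) k) (suc m))
  ≡⟨ cong (λ z → suc m * U + (V + z)) (binomialSum-absorb (suc m) (λ c k → F (suc c) k)) ⟩
    suc m * U + (V + suc m * W)
  ≡⟨ regroup m U V W ⟩
    V + suc m * (U + W)
  ∎
  where
  open ≡-Reasoning
  U V W : ℕ
  U = binomialSum (λ c k → F (suc c) (suc k)) m
  V = binomialSum (λ c k → F (suc c) k) (suc m)
  W = binomialSum (λ c k → F (suc (suc c)) k) m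
  regroup : ∀ m a b c → suc m * a + (b + suc m * c) ≡ b + suc m * (a + c)
  regroup = solve-∀

binomialSum-pow : ∀ L x → binomialSum (λ _ k → x ^ k) L ≡ suc x ^ L
binomialSum-pow zero    x = refl
binomialSum-pow (suc L) x = begin
    binomialSum (λ _ k → x * x ^ k) L + binomialSum (λ _ k → x ^ k) L
  ≡⟨ cong₂ _+_ (trans (binomialSum-*ˡ L x (λ _ k → x ^ k)) (cong (x *_) (binomialSum-pow L x)))
               (binomialSum-pow L x) ⟩
    x * suc x ^ L + suc x ^ L
  ≡⟨ +-comm (x * suc x ^ L) _ ⟩
    suc x ^ L + x * suc x ^ L
  ∎
  where open ≡-Reasoning

binomialSum-pred : ∀ L (F : ℕ → ℕ) →
  binomialSum (λ c k → (c ∸ 1) * F k) L + binomialSum (λ _ k → F k) L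
    ≡ L * binomialSum (λ _ k → F k) (L ∸ 1) + F L
binomialSum-pred L F = begin
    binomialSum (λ c k → (c ∸ 1) * F k) L + binomialSum (λ _ k → F k) L
  ≡⟨ sym (binomialSum-distrib-+ L (λ c k → (c ∸ 1) * F k) (λ _ k → F k)) ⟩
    binomialSum (λ c k → (c ∸ 1) * F k + F k) L
  ≡⟨ binomialSum-ext L (λ c k → pred-split c (F k)) ⟩
    binomialSum (λ c k → c * F k + (F k when (c ≡ᵇ 0))) L
  ≡⟨ binomialSum-distrib-+ L (λ c k → c * F k) (λ c k → F k when (c ≡ᵇ 0)) ⟩
    binomialSum (λ c k → c * F k) L + binomialSum (λ c k → F k when (c ≡ᵇ 0)) L
  ≡⟨ cong₂ _+_ (binomialSum-absorb L (λ _ k → F k)) (binomialSum-δ L F) ⟩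
    L * binomialSum (λ _ k → F k) (L ∸ 1) + F L
  ∎
  where
  open ≡-Reasoning
  pred-split : ∀ c x → (c ∸ 1) * x + x ≡ c * x + (x when (c ≡ᵇ 0))
  pred-split zero    x = refl
  pred-split (suc c) x = trans (+-comm (c * x) x) (sym (+-identityʳ _))

binomialSum-linear : ∀ L a (F : ℕ → ℕ) →
  binomialSum (λ c k → (a + c) * F k) L
    ≡ a * binomialSum (λ _ k → F k) L + L * binomialSum (λ _ k → F k) (L ∸ 1)
binomialSum-linear L a F = begin
    binomialSum (λ c k → (a + c) * F k) L
  ≡⟨ binomialSum-ext L (λ c k → *-distribʳ-+ (F k) a c) ⟩
    binomialSum (λ c k → a * F k + c * F k) L
  ≡⟨ binomialSum-distrib-+ L (λ _ k → a * F k) (λ c k → c * F k) ⟩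
    binomialSum (λ _ k → a * F k) L + binomialSum (λ c k → c * F k) L
  ≡⟨ cong₂ _+_ (binomialSum-*ˡ L a (λ _ k → F k)) (binomialSum-absorb L (λ _ k → F k)) ⟩
    a * binomialSum (λ _ k → F k) L + L * binomialSum (λ _ k → F k) (L ∸ 1)
  ∎
  where open ≡-Reasoning

binomialSum-linear-pow : ∀ L a Y →
  binomialSum (λ c k → (a + c) * Y ^ k) L ≡ a * suc Y ^ L + L * suc Y ^ (L ∸ 1)
binomialSum-linear-pow L a Y =
  trans (binomialSum-linear L a (Y ^_))
        (cong₂ (λ u v → a * u + L * v) (binomialSum-pow L Y) (binomialSum-pow (L ∸ 1) Y))

binomialSum-pred-pow : ∀ L x →
  binomialSum (λ c k → (c ∸ 1) * x ^ k) L + suc x ^ L ≡ L * suc x ^ (L ∸ 1) + x ^ L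
binomialSum-pred-pow L x = begin
    binomialSum (λ c k → (c ∸ 1) * x ^ k) L + suc x ^ L
  ≡⟨ cong (binomialSum (λ c k → (c ∸ 1) * x ^ k) L +_) (binomialSum-pow L x) ⟨
    binomialSum (λ c k → (c ∸ 1) * x ^ k) L + binomialSum (λ _ k → x ^ k) L
  ≡⟨ binomialSum-pred L (x ^_) ⟩
    L * binomialSum (λ _ k → x ^ k) (L ∸ 1) + x ^ L
  ≡⟨ cong (λ z → L * z + x ^ L) (binomialSum-pow (L ∸ 1) x) ⟩
    L * suc x ^ (L ∸ 1) + x ^ L
  ∎
  where open ≡-Reasoning

pow-pred-* : ∀ j z → z * (j * z ^ (j ∸ 1)) ≡ j * z ^ j
pow-pred-* zero    z = *-zeroʳ z
pow-pred-* (suc j) z = x∙yz≈y∙xz z (suc j) (z ^ j)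

binomialSum-pred-pow-self : ∀ n →
  suc n * binomialSum (λ c k → (c ∸ 1) * n ^ k) n + suc n ^ n ≡ suc n * n ^ n
binomialSum-pred-pow-self n = +-cancelʳ-≡ (n * suc n ^ n) _ _ (begin
    suc n * X + suc n ^ n + n * suc n ^ n
  ≡⟨ factor n X (suc n ^ n) ⟩
    suc n * (X + suc n ^ n)
  ≡⟨ cong (suc n *_) (binomialSum-pred-pow n n) ⟩
    suc n * (n * suc n ^ (n ∸ 1) + n ^ n)
  ≡⟨ *-distribˡ-+ (suc n) _ (n ^ n) ⟩
    suc n * (n * suc n ^ (n ∸ 1)) + suc n * n ^ n
  ≡⟨ cong (_+ suc n * n ^ n) (pow-pred-* n (suc n)) ⟩
    n * suc n ^ n + suc n * n ^ n
  ≡⟨ +-comm (n * suc n ^ n) _ ⟩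
    suc n * n ^ n + n * suc n ^ n
  ∎)
  where
  open ≡-Reasoning
  X : ℕ
  X = binomialSum (λ c k → (c ∸ 1) * n ^ k) n
  factor : ∀ n x p → suc n * x + p + n * p ≡ suc n * (x + p)
  factor = solve-∀

powerConvolution : (ℕ → ℕ) → ℕ → ℕ → ℕ
powerConvolution v Y = binomialSum (λ c k → v c * Y ^ k)

powerConvolution-suc : ∀ v Y k →
  powerConvolution v Y (suc k) ≡ Y * powerConvolution v Y k + powerConvolution (v ∘ suc) Y k
powerConvolution-suc v Y k = cong (_+ powerConvolution (v ∘ suc) Y k) (begin
    binomialSum (λ c k → v c * (Y * Y ^ k)) k
  ≡⟨ binomialSum-ext k (λ c k → x∙yz≈y∙xz (v c) Y (Y ^ k)) ⟩
    binomialSum (λ c k → Y * (v c * Y ^ k)) k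
  ≡⟨ binomialSum-*ˡ k Y (λ c k → v c * Y ^ k) ⟩
    Y * powerConvolution v Y k
  ∎)
  where open ≡-Reasoning

binomialSum-powerConvolution : ∀ m v Y →
  binomialSum (λ _ k → powerConvolution v Y k) m ≡ powerConvolution v (suc Y) m
binomialSum-powerConvolution zero    v Y = refl
binomialSum-powerConvolution (suc m) v Y = begin
    binomialSum (λ _ k → P v Y (suc k)) m + binomialSum (λ _ k → P v Y k) m
  ≡⟨ cong (_+ binomialSum (λ _ k → P v Y k) m) (begin
      binomialSum (λ _ k → P v Y (suc k)) m
    ≡⟨ binomialSum-ext m (λ _ k → powerConvolution-suc v Y k) ⟩
      binomialSum (λ _ k → Y * P v Y k + P (v ∘ suc) Y k) m
    ≡⟨ binomialSum-distrib-+ m (λ _ k → Y * P v Y k) (λ _ k → P (v ∘ suc) Y k) ⟩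
      binomialSum (λ _ k → Y * P v Y k) m + binomialSum (λ _ k → P (v ∘ suc) Y k) m
    ≡⟨ cong (_+ binomialSum (λ _ k → P (v ∘ suc) Y k) m) (binomialSum-*ˡ m Y (λ _ k → P v Y k)) ⟩
      Y * binomialSum (λ _ k → P v Y k) m + binomialSum (λ _ k → P (v ∘ suc) Y k) m
    ∎) ⟩
    Y * binomialSum (λ _ k → P v Y k) m + binomialSum (λ _ k → P (v ∘ suc) Y k) m
      + binomialSum (λ _ k → P v Y k) m
  ≡⟨ cong₂ _+_ (cong₂ _+_ (cong (Y *_) IH) (binomialSum-powerConvolution m (v ∘ suc) Y)) IH ⟩
    Y * P v (suc Y) m + P (v ∘ suc) (suc Y) m + P v (suc Y) m
  ≡⟨ regroup Y (P v (suc Y) m) (P (v ∘ suc) (suc Y) m) ⟩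
    suc Y * P v (suc Y) m + P (v ∘ suc) (suc Y) m
  ≡⟨ sym (powerConvolution-suc v (suc Y) m) ⟩
    P v (suc Y) (suc m)
  ∎
  where
  open ≡-Reasoning
  P : (ℕ → ℕ) → ℕ → ℕ → ℕ
  P = powerConvolution
  IH : binomialSum (λ _ k → P v Y k) m ≡ P v (suc Y) m
  IH = binomialSum-powerConvolution m v Y
  regroup : ∀ y a b → y * a + b + a ≡ suc y * a + b
  regroup = solve-∀

-- m! · ∑_{s ≤ m} Y ^ s / s!
truncExp : ℕ → ℕ → ℕ
truncExp m Y = powerConvolution _! Y m

truncExp-pred : ∀ m Y → truncExp m Y ≡ Y ^ m + m * truncExp (m ∸ 1) Y
truncExp-pred m Y = begin
    binomialSum (λ c k → c ! * Y ^ k) m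
  ≡⟨ binomialSum-ext m (λ c k → factorial-split c (Y ^ k)) ⟩
    binomialSum (λ c k → (Y ^ k when (c ≡ᵇ 0)) + c * ((c ∸ 1) ! * Y ^ k)) m
  ≡⟨ binomialSum-distrib-+ m (λ c k → Y ^ k when (c ≡ᵇ 0)) (λ c k → c * ((c ∸ 1) ! * Y ^ k)) ⟩
    binomialSum (λ c k → Y ^ k when (c ≡ᵇ 0)) m + binomialSum (λ c k → c * ((c ∸ 1) ! * Y ^ k)) m
  ≡⟨ cong₂ _+_ (binomialSum-δ m (Y ^_)) (binomialSum-absorb m (λ c k → (c ∸ 1) ! * Y ^ k)) ⟩
    Y ^ m + m * truncExp (m ∸ 1) Y
  ∎
  where
  open ≡-Reasoning
  factorial-split : ∀ c x → c ! * x ≡ (x when (c ≡ᵇ 0)) + c * ((c ∸ 1) ! * x)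
  factorial-split zero    x = refl
  factorial-split (suc c) x = *-assoc (suc c) (c !) x

binomialSum-linear-truncExp : ∀ L a Y →
  binomialSum (λ c k → (a + c) * truncExp k Y) L ≡ a * truncExp L (suc Y) + L * truncExp (L ∸ 1) (suc Y)
binomialSum-linear-truncExp L a Y =
  trans (binomialSum-linear L a (λ k → truncExp k Y))
        (cong₂ (λ u v → a * u + L * v) (binomialSum-powerConvolution L _! Y)
                                       (binomialSum-powerConvolution (L ∸ 1) _! Y))

binomialSum-pred-truncExp : ∀ L Y →
  binomialSum (λ c k → (c ∸ 1) * truncExp k Y) L + suc Y ^ L ≡ truncExp L Y
binomialSum-pred-truncExp L Y = +-cancelʳ-≡ (L * q) _ _ (begin
    X + suc Y ^ L + L * q
  ≡⟨ +-assoc X (suc Y ^ L) (L * q) ⟩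
    X + (suc Y ^ L + L * q)
  ≡⟨ cong (X +_) (trans (binomialSum-powerConvolution L _! Y) (truncExp-pred L (suc Y))) ⟨
    X + binomialSum (λ _ k → truncExp k Y) L
  ≡⟨ binomialSum-pred L (λ k → truncExp k Y) ⟩
    L * binomialSum (λ _ k → truncExp k Y) (L ∸ 1) + truncExp L Y
  ≡⟨ cong (λ z → L * z + truncExp L Y) (binomialSum-powerConvolution (L ∸ 1) _! Y) ⟩
    L * q + truncExp L Y
  ≡⟨ +-comm (L * q) _ ⟩
    truncExp L Y + L * q
  ∎)
  where
  open ≡-Reasoning
  X q : ℕ
  X = binomialSum (λ c k → (c ∸ 1) * truncExp k Y) L
  q = truncExp (L ∸ 1) (suc Y)

-- Splitting off the entries equal to 1

seqs-suc : ∀ (f : List ℕ → ℕ) m k →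
  ∑[ x ← seqs m (suc k) ] f x ≡ ∑[ j ← upTo m ] ∑[ y ← seqs m k ] f (suc j ∷ y)
seqs-suc f m k = begin
    sumOver f (concatMap (λ v → map (v ∷_) (seqs m k)) (map suc (upTo m)))
  ≡⟨ sumOver-concatMap f (λ v → map (v ∷_) (seqs m k)) (map suc (upTo m)) ⟩
    ∑[ v ← map suc (upTo m) ] sumOver f (map (v ∷_) (seqs m k))
  ≡⟨ sumOver-map (λ v → sumOver f (map (v ∷_) (seqs m k))) suc (upTo m) ⟩
    ∑[ j ← upTo m ] sumOver f (map (suc j ∷_) (seqs m k))
  ≡⟨ sumOver-cong (upTo m) (λ j → sumOver-map f (suc j ∷_) (seqs m k)) ⟩
    ∑[ j ← upTo m ] ∑[ y ← seqs m k ] f (suc j ∷ y)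
  ∎
  where open ≡-Reasoning

sumOver-seqs-suc-cong : ∀ {f g : List ℕ → ℕ} m k → (∀ j y → f (suc j ∷ y) ≡ g (suc j ∷ y)) →
  ∑[ x ← seqs m (suc k) ] f x ≡ ∑[ x ← seqs m (suc k) ] g x
sumOver-seqs-suc-cong {f} {g} m k f≗g = begin
    ∑[ x ← seqs m (suc k) ] f x
  ≡⟨ seqs-suc f m k ⟩
    ∑[ j ← upTo m ] ∑[ y ← seqs m k ] f (suc j ∷ y)
  ≡⟨ sumOver-cong (upTo m) (λ j → sumOver-cong (seqs m k) (f≗g j)) ⟩
    ∑[ j ← upTo m ] ∑[ y ← seqs m k ] g (suc j ∷ y)
  ≡⟨ seqs-suc g m k ⟨
    ∑[ x ← seqs m (suc k) ] g x
  ∎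
  where open ≡-Reasoning

sumOver-first-split : ∀ m L (P : List ℕ → Bool) →
  ∑[ x ← seqs m (suc L) ] (first x when P x)
    ≡ ∑[ x ← seqs m (suc L) ] (1 when P x) + ∑[ x ← seqs m (suc L) ] (pred (first x) when P x)
sumOver-first-split m L P =
  trans (sumOver-seqs-suc-cong m L (λ j y → suc-when j (P (suc j ∷ y))))
        (sumOver-distrib-+ (λ x → 1 when P x) (λ x → pred (first x) when P x) (seqs m (suc L)))
  where
  suc-when : ∀ j b → suc j when b ≡ 1 when b + j when b
  suc-when j true  = refl
  suc-when j false = refl

ones : List ℕ → ℕ
ones = length ∘ filter (_≟ 1)

rest : List ℕ → List ℕ
rest = map pred ∘ filter (∁? (_≟ 1))

-- A sequence over 1..M+1 is determined by the positions of its 1s and by rest x, a sequence over 1..M.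
sumOver-peel : ∀ M L (h : ℕ → List ℕ → ℕ) →
  ∑[ x ← seqs (suc M) L ] h (ones x) (rest x) ≡ binomialSum (λ c k → ∑[ r ← seqs M k ] h c r) L
sumOver-peel M zero    h = refl
sumOver-peel M (suc L) h = begin
    ∑[ x ← seqs (suc M) (suc L) ] h (ones x) (rest x)
  ≡⟨ seqs-suc (λ x → h (ones x) (rest x)) (suc M) L ⟩
    ∑[ j ← upTo (suc M) ] ∑[ y ← S ] h (ones (suc j ∷ y)) (rest (suc j ∷ y))
  ≡⟨ sumOver-upTo-suc (λ j → ∑[ y ← S ] h (ones (suc j ∷ y)) (rest (suc j ∷ y))) M ⟩
    ∑[ y ← S ] h (suc (ones y)) (rest y) + ∑[ j ← upTo M ] ∑[ y ← S ] h (ones y) (suc j ∷ rest y)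
  ≡⟨ cong₂ _+_ (sumOver-peel M L (h ∘ suc))
               (sumOver-cong (upTo M) (λ j → sumOver-peel M L (λ c r → h c (suc j ∷ r)))) ⟩
    leadingOne + ∑[ j ← upTo M ] binomialSum (λ c k → ∑[ r ← seqs M k ] h c (suc j ∷ r)) L
  ≡⟨ cong (leadingOne +_) (binomialSum-sumOver L (λ j c k → ∑[ r ← seqs M k ] h c (suc j ∷ r)) (upTo M)) ⟨
    leadingOne + binomialSum (λ c k → ∑[ j ← upTo M ] ∑[ r ← seqs M k ] h c (suc j ∷ r)) L
  ≡⟨ cong (leadingOne +_) (binomialSum-ext L (λ c k → seqs-suc (h c) M k)) ⟨
    leadingOne + binomialSum (λ c k → ∑[ r ← seqs M (suc k) ] h c r) L
  ≡⟨ +-comm leadingOne _ ⟩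
    binomialSum (λ c k → ∑[ r ← seqs M k ] h c r) (suc L)
  ∎
  where
  open ≡-Reasoning
  S : List (List ℕ)
  S = seqs (suc M) L
  leadingOne : ℕ
  leadingOne = binomialSum (λ c k → ∑[ r ← seqs M k ] h (suc c) r) L

-- parks M a x: the cars with preferences x (entries in 1..M) all park when a ∸ 1 further cars already
-- queue at spot 1 (a = 0: one car preferring spot 1 is turned away).  Spot 1 takes one of the
-- a ∸ 1 + ones x queuing cars, the others queue at spot 2, and relabelling spot 2 as spot 1 leaves the
-- preferences rest x.  For a = 1 this is the parking condition, for a = 0 the prime one.
mutual
  parks : ℕ → ℕ → List ℕ → Bool
  parks zero    a x = null x
  parks (suc M) a x = parksRest M (a + ones x) (rest x)

  parksRest : ℕ → ℕ → List ℕ → Bool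
  parksRest M s r = null r ∨ ((2 ≤ᵇ s) ∧ parks M (s ∸ 1) r)

sumParks : (List ℕ → ℕ) → ℕ → ℕ → ℕ → ℕ
sumParks w M a L = ∑[ x ← seqs M L ] (w x when parks M a x)

sumParksRest : (List ℕ → ℕ) → ℕ → ℕ → ℕ → ℕ
sumParksRest w M s k = ∑[ r ← seqs M k ] (w r when parksRest M s r)

countParks : ℕ → ℕ → ℕ → ℕ
countParks = sumParks (λ _ → 1)

sumFirstParks : ℕ → ℕ → ℕ → ℕ
sumFirstParks = sumParks first

countParksRest : ℕ → ℕ → ℕ → ℕ
countParksRest = sumParksRest (λ _ → 1)

sumFirstParksRest : ℕ → ℕ → ℕ → ℕ
sumFirstParksRest = sumParksRest first

sumParksRest-suc : ∀ w M s j → sumParksRest w M s (suc j) ≡ sumParks w M (s ∸ 1) (suc j) when (2 ≤ᵇ s)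
sumParksRest-suc w M s j =
  trans (sumOver-seqs-suc-cong M j (λ i y → when-∧ (w (suc i ∷ y)) (2 ≤ᵇ s) (parks M (s ∸ 1) (suc i ∷ y))))
        (sumOver-when (λ r → w r when parks M (s ∸ 1) r) (2 ≤ᵇ s) (seqs M (suc j)))

countParks-suc : ∀ M a L →
  countParks (suc M) a L ≡ binomialSum (λ c k → countParksRest M (a + c) k) L
countParks-suc M a L = sumOver-peel M L (λ c r → 1 when parksRest M (a + c) r)

sumOver-pred-first : ∀ M a L →
  ∑[ x ← seqs (suc M) (suc L) ] (pred (first x) when parks (suc M) a x)
    ≡ binomialSum (λ c k → sumFirstParksRest M (a + c) (suc k)) L
sumOver-pred-first M a L = begin
    ∑[ x ← seqs (suc M) (suc L) ] (pred (first x) when parks (suc M) a x)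
  ≡⟨ seqs-suc _ (suc M) L ⟩
    ∑[ j ← upTo (suc M) ] ∑[ y ← S ] (j when parks (suc M) a (suc j ∷ y))
  ≡⟨ sumOver-upTo-suc _ M ⟩
    ∑[ y ← S ] (0 when parks (suc M) a (1 ∷ y)) + ∑[ j ← upTo M ] ∑[ y ← S ] (suc j when R j (ones y) (rest y))
  ≡⟨ cong₂ _+_ (trans (sumOver-cong S (λ y → 0-when _)) (sumOver-zero S))
               (sumOver-cong (upTo M) (λ j → sumOver-peel M L (λ c r → suc j when R j c r))) ⟩
    ∑[ j ← upTo M ] binomialSum (λ c k → ∑[ r ← seqs M k ] (suc j when R j c r)) L
  ≡⟨ binomialSum-sumOver L (λ j c k → ∑[ r ← seqs M k ] (suc j when R j c r)) (upTo M) ⟨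
    binomialSum (λ c k → ∑[ j ← upTo M ] ∑[ r ← seqs M k ] (suc j when R j c r)) L
  ≡⟨ binomialSum-ext L (λ c k → seqs-suc (λ r → first r when parksRest M (a + c) r) M k) ⟨
    binomialSum (λ c k → sumFirstParksRest M (a + c) (suc k)) L
  ∎
  where
  open ≡-Reasoning
  S : List (List ℕ)
  S = seqs (suc M) L
  R : ℕ → ℕ → List ℕ → Bool
  R j c r = parksRest M (a + c) (suc j ∷ r)

sumFirstParks-suc : ∀ M a L →
  sumFirstParks (suc M) a (suc L)
    ≡ countParks (suc M) a (suc L) + binomialSum (λ c k → sumFirstParksRest M (a + c) (suc k)) L
sumFirstParks-suc M a L =
  trans (sumOver-first-split (suc M) L (parks (suc M) a))
        (cong (countParks (suc M) a (suc L) +_) (sumOver-pred-first M a L))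

-- Abel-type evaluation

-- Scaling by Y = a + L ∸ 1 turns each term of the convolution into (a + c ∸ 1) · Y ^ k, including the
-- k = 0 term 1, so that the binomial theorem applies.
mutual
  countParks-shifted : ∀ M a j → a + j < M → countParks M (suc a) (suc j) ≡ suc a * (2 + a + j) ^ j
  countParks-shifted (suc M) a j (s≤s a+j≤M) = *-cancelˡ-≡ _ _ B (begin
      B * countParks (suc M) (suc a) (suc j)
    ≡⟨ countParks-scaled M (suc a) (suc j) B (cong suc (+-suc a j)) (s≤s a+j≤M) ⟩
      binomialSum (λ c k → (a + c) * B ^ k) (suc j)
    ≡⟨ binomialSum-linear-pow (suc j) a B ⟩
      a * suc B ^ suc j + suc j * suc B ^ j
    ≡⟨ abel a j (suc B ^ j) ⟩
      B * (suc a * suc B ^ j)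
    ∎)
    where
    open ≡-Reasoning
    B : ℕ
    B = suc (a + j)
    abel : ∀ a j p → a * (suc (suc (a + j)) * p) + suc j * p ≡ suc (a + j) * (suc a * p)
    abel = solve-∀

  countParks-scaled : ∀ M a L Y → a + L ≡ suc Y → Y ≤ suc M →
    Y * countParks (suc M) a L ≡ binomialSum (λ c k → (a + c ∸ 1) * Y ^ k) L
  countParks-scaled M a L Y a+L≡1+Y Y≤1+M = begin
      Y * countParks (suc M) a L
    ≡⟨ cong (Y *_) (countParks-suc M a L) ⟩
      Y * binomialSum (λ c k → countParksRest M (a + c) k) L
    ≡⟨ binomialSum-*ˡ L Y (λ c k → countParksRest M (a + c) k) ⟨
      binomialSum (λ c k → Y * countParksRest M (a + c) k) L
    ≡⟨ binomialSum-cong L (λ c k c+k≡L → countParksRest-scaled M (a + c) k Y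
                             (trans (+-assoc a c k) (trans (cong (a +_) c+k≡L) a+L≡1+Y)) Y≤1+M) ⟩
      binomialSum (λ c k → (a + c ∸ 1) * Y ^ k) L
    ∎
    where open ≡-Reasoning

  countParksRest-scaled : ∀ M s k Y → s + k ≡ suc Y → Y ≤ suc M →
    Y * countParksRest M s k ≡ (s ∸ 1) * Y ^ k
  countParksRest-scaled M s zero    Y s+0≡1+Y _ =
    cong (λ z → (z ∸ 1) * 1) (trans (sym s+0≡1+Y) (+-identityʳ s))
  countParksRest-scaled M s (suc i) Y s+k≡1+Y Y≤1+M =
    trans (cong (Y *_) (sumParksRest-suc (λ _ → 1) M s i)) (by-cases s s+k≡1+Y)
    where
    open ≡-Reasoning
    by-cases : ∀ s → s + suc i ≡ suc Y → Y * (countParks M (s ∸ 1) (suc i) when (2 ≤ᵇ s)) ≡ (s ∸ 1) * Y ^ suc i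
    by-cases 0             _ = *-zeroʳ Y
    by-cases 1             _ = *-zeroʳ Y
    by-cases (suc (suc s)) e = begin
        Y * countParks M (suc s) (suc i)
      ≡⟨ cong (Y *_) (countParks-shifted M s i (s≤s⁻¹ (subst (_≤ suc M) (sym Y≡) Y≤1+M))) ⟩
        Y * (suc s * (2 + s + i) ^ i)
      ≡⟨ cong (λ z → Y * (suc s * z ^ i)) Y≡ ⟩
        Y * (suc s * Y ^ i)
      ≡⟨ x∙yz≈y∙xz Y (suc s) (Y ^ i) ⟩
        suc s * Y ^ suc i
      ∎
      where
      Y≡ : 2 + s + i ≡ Y
      Y≡ = trans (cong suc (sym (+-suc s i))) (suc-injective e)

mutual
  sumFirstParks-shifted : ∀ M a j → a + j < M →
    2 * sumFirstParks M (suc a) (suc j) + suc a * truncExp j (2 + a + j)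
      ≡ suc a * (2 + a + j) ^ j * (3 + a + j)
  sumFirstParks-shifted (suc M) a j (s≤s a+j≤M) = begin
      2 * sumFirstParks (suc M) (suc a) (suc j) + suc a * truncExp j Z
    ≡⟨ cong₂ (λ u v → 2 * u + suc a * v)
             (trans (sumFirstParks-suc M (suc a) j) (cong (_+ t) (countParks-shifted (suc M) a j (s≤s a+j≤M))))
             (truncExp-pred j Z) ⟩
      2 * (suc a * P + t) + suc a * (P + j * q)
    ≡⟨ regroup a j P q t ⟩
      (2 * t + (a * (P + j * q) + j * q)) + (2 * suc a * P + P)
    ≡⟨ cong (_+ (2 * suc a * P + P)) binomial-part ⟩
      Z * (a * P + j * Z ^ (j ∸ 1)) + (2 * suc a * P + P)
    ≡⟨ cong (_+ (2 * suc a * P + P)) (trans (*-distribˡ-+ Z (a * P) _) (cong (Z * (a * P) +_) (pow-pred-* j Z))) ⟩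
      Z * (a * P) + j * P + (2 * suc a * P + P)
    ≡⟨ finish a j P ⟩
      suc a * P * (3 + a + j)
    ∎
    where
    open ≡-Reasoning
    Y Z P q t : ℕ
    Y = suc (a + j)
    Z = suc Y
    P = Z ^ j
    q = truncExp (j ∸ 1) Z
    t = binomialSum (λ c k → sumFirstParksRest M (suc a + c) (suc k)) j
    binomial-part : 2 * t + (a * (P + j * q) + j * q) ≡ Z * (a * P + j * Z ^ (j ∸ 1))
    binomial-part = begin
        2 * t + (a * (P + j * q) + j * q)
      ≡⟨ cong (λ z → 2 * t + (a * z + j * q)) (truncExp-pred j Z) ⟨
        2 * t + (a * truncExp j Z + j * q)
      ≡⟨ cong (2 * t +_) (binomialSum-linear-truncExp j a Y) ⟨
        2 * t + binomialSum (λ c k → (a + c) * truncExp k Y) j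
      ≡⟨ sumFirstParksRest-binomial M (suc a) j Y refl (s≤s a+j≤M) ⟩
        Z * binomialSum (λ c k → (a + c) * Y ^ k) j
      ≡⟨ cong (Z *_) (binomialSum-linear-pow j a Y) ⟩
        Z * (a * P + j * Z ^ (j ∸ 1))
      ∎
    regroup : ∀ a j P q t → 2 * (suc a * P + t) + suc a * (P + j * q)
                              ≡ (2 * t + (a * (P + j * q) + j * q)) + (2 * suc a * P + P)
    regroup = solve-∀
    finish : ∀ a j P → suc (suc (a + j)) * (a * P) + j * P + (2 * suc a * P + P) ≡ suc a * P * (3 + a + j)
    finish = solve-∀

  sumFirstParksRest-binomial : ∀ M a L Y → a + L ≡ Y → Y ≤ suc M →
    2 * binomialSum (λ c k → sumFirstParksRest M (a + c) (suc k)) L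
      + binomialSum (λ c k → (a + c ∸ 1) * truncExp k Y) L
      ≡ suc Y * binomialSum (λ c k → (a + c ∸ 1) * Y ^ k) L
  sumFirstParksRest-binomial M a L Y a+L≡Y Y≤1+M = begin
      2 * binomialSum R L + binomialSum (λ c k → (a + c ∸ 1) * truncExp k Y) L
    ≡⟨ cong (_+ binomialSum (λ c k → (a + c ∸ 1) * truncExp k Y) L) (binomialSum-*ˡ L 2 R) ⟨
      binomialSum (λ c k → 2 * R c k) L + binomialSum (λ c k → (a + c ∸ 1) * truncExp k Y) L
    ≡⟨ binomialSum-distrib-+ L (λ c k → 2 * R c k) (λ c k → (a + c ∸ 1) * truncExp k Y) ⟨
      binomialSum (λ c k → 2 * R c k + (a + c ∸ 1) * truncExp k Y) L
    ≡⟨ binomialSum-cong L (λ c k c+k≡L → sumFirstParksRest-scaled M (a + c) k Y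
                             (trans (+-assoc a c k) (trans (cong (a +_) c+k≡L) a+L≡Y)) Y≤1+M) ⟩
      binomialSum (λ c k → (a + c ∸ 1) * (Y ^ k * suc Y)) L
    ≡⟨ binomialSum-ext L (λ c k → x∙yz≈z∙xy (a + c ∸ 1) (Y ^ k) (suc Y)) ⟩
      binomialSum (λ c k → suc Y * ((a + c ∸ 1) * Y ^ k)) L
    ≡⟨ binomialSum-*ˡ L (suc Y) (λ c k → (a + c ∸ 1) * Y ^ k) ⟩
      suc Y * binomialSum (λ c k → (a + c ∸ 1) * Y ^ k) L
    ∎
    where
    open ≡-Reasoning
    R : ℕ → ℕ → ℕ
    R c k = sumFirstParksRest M (a + c) (suc k)

  sumFirstParksRest-scaled : ∀ M s k Y → s + k ≡ Y → Y ≤ suc M →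
    2 * sumFirstParksRest M s (suc k) + (s ∸ 1) * truncExp k Y ≡ (s ∸ 1) * (Y ^ k * suc Y)
  sumFirstParksRest-scaled M s k Y s+k≡Y Y≤1+M =
    trans (cong (λ z → 2 * z + (s ∸ 1) * truncExp k Y) (sumParksRest-suc first M s k)) (by-cases s s+k≡Y)
    where
    open ≡-Reasoning
    by-cases : ∀ s → s + k ≡ Y →
      2 * (sumFirstParks M (s ∸ 1) (suc k) when (2 ≤ᵇ s)) + (s ∸ 1) * truncExp k Y ≡ (s ∸ 1) * (Y ^ k * suc Y)
    by-cases 0             _ = refl
    by-cases 1             _ = refl
    by-cases (suc (suc s)) Y≡ = begin
        2 * sumFirstParks M (suc s) (suc k) + suc s * truncExp k Y
      ≡⟨ cong (λ z → 2 * sumFirstParks M (suc s) (suc k) + suc s * truncExp k z) Y≡ ⟨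
        2 * sumFirstParks M (suc s) (suc k) + suc s * truncExp k (2 + s + k)
      ≡⟨ sumFirstParks-shifted M s k (s≤s⁻¹ (subst (_≤ suc M) (sym Y≡) Y≤1+M)) ⟩
        suc s * (2 + s + k) ^ k * (3 + s + k)
      ≡⟨ cong (λ z → suc s * z ^ k * suc z) Y≡ ⟩
        suc s * Y ^ k * suc Y
      ≡⟨ *-assoc (suc s) (Y ^ k) (suc Y) ⟩
        suc s * (Y ^ k * suc Y)
      ∎

countParks-prime : ∀ n .{{_ : NonZero n}} → countParks (suc n) 0 (suc n) ≡ n ^ n
countParks-prime n = *-cancelˡ-≡ _ _ n (begin
    n * countParks (suc n) 0 (suc n)
  ≡⟨ countParks-scaled n 0 (suc n) n refl (n≤1+n n) ⟩
    binomialSum (λ c k → (c ∸ 1) * n ^ k) (suc n)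
  ≡⟨ +-cancelʳ-≡ (suc n ^ suc n) _ _ (trans (binomialSum-pred-pow (suc n) n) (+-comm (suc n ^ suc n) _)) ⟩
    n * n ^ n
  ∎)
  where open ≡-Reasoning

sumFirstParks-prime : ∀ n .{{_ : NonZero n}} →
  2 * sumFirstParks (suc n) 0 (suc n) + truncExp n n ≡ (n + 3) * n ^ n
sumFirstParks-prime n = begin
    2 * sumFirstParks (suc n) 0 (suc n) + truncExp n n
  ≡⟨ cong₂ (λ u v → 2 * u + v)
           (trans (sumFirstParks-suc n 0 n) (cong (_+ t) (countParks-prime n)))
           (sym (binomialSum-pred-truncExp n n)) ⟩
    2 * (n ^ n + t) + (X₁ + suc n ^ n)
  ≡⟨ regroup (n ^ n) t X₁ (suc n ^ n) ⟩
    2 * n ^ n + ((2 * t + X₁) + suc n ^ n)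
  ≡⟨ cong (λ z → 2 * n ^ n + (z + suc n ^ n)) (sumFirstParksRest-binomial n 0 n n refl (n≤1+n n)) ⟩
    2 * n ^ n + (suc n * X₂ + suc n ^ n)
  ≡⟨ cong (2 * n ^ n +_) (binomialSum-pred-pow-self n) ⟩
    2 * n ^ n + suc n * n ^ n
  ≡⟨ finish n (n ^ n) ⟩
    (n + 3) * n ^ n
  ∎
  where
  open ≡-Reasoning
  t X₁ X₂ : ℕ
  t  = binomialSum (λ c k → sumFirstParksRest n c (suc k)) n
  X₁ = binomialSum (λ c k → (c ∸ 1) * truncExp k n) n
  X₂ = binomialSum (λ c k → (c ∸ 1) * n ^ k) n
  regroup : ∀ N t x p → 2 * (N + t) + (x + p) ≡ 2 * N + ((2 * t + x) + p)
  regroup = solve-∀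
  finish : ∀ n N → 2 * N + suc n * N ≡ (n + 3) * N
  finish = solve-∀

-- parks agrees with isPF and isPPF

InRange : ℕ → ℕ → Set
InRange M v = 1 ≤ v × v ≤ M

null-↭ : {xs ys : List A} → xs ↭ ys → null xs ≡ null ys
null-↭ ↭.refl        = refl
null-↭ (↭.prep _ _)  = refl
null-↭ (↭.swap _ _ _) = refl
null-↭ (↭.trans p q) = trans (null-↭ p) (null-↭ q)

ones-↭ : ∀ {xs ys} → xs ↭ ys → ones xs ≡ ones ys
ones-↭ p = ↭-length (filter-↭ (_≟ 1) p)

rest-↭ : ∀ {xs ys} → xs ↭ ys → rest xs ↭ rest ys
rest-↭ p = map⁺ pred (filter-↭ (∁? (_≟ 1)) p)

mutual
  parks-↭ : ∀ M a {xs ys} → xs ↭ ys → parks M a xs ≡ parks M a ys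
  parks-↭ zero    a p = null-↭ p
  parks-↭ (suc M) a {xs} {ys} p =
    trans (cong (λ c → parksRest M (a + c) (rest xs)) (ones-↭ p)) (parksRest-↭ M (a + ones ys) (rest-↭ p))

  parksRest-↭ : ∀ M s {xs ys} → xs ↭ ys → parksRest M s xs ≡ parksRest M s ys
  parksRest-↭ M s p = cong₂ _∨_ (null-↭ p) (cong ((2 ≤ᵇ s) ∧_) (parks-↭ M (s ∸ 1) p))

mutual
  parks-mono : ∀ M a x → parks M a x ≡ true → parks M (suc a) x ≡ true
  parks-mono zero    a x h = h
  parks-mono (suc M) a x h = parksRest-mono M (a + ones x) (rest x) h

  parksRest-mono : ∀ M s r → parksRest M s r ≡ true → parksRest M (suc s) r ≡ true
  parksRest-mono M s             []      h = refl
  parksRest-mono M (suc (suc s)) (v ∷ r) h = parks-mono M (suc s) (v ∷ r) h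

boundedFrom-map-suc : ∀ b r → boundedFrom (suc b) (map suc r) ≡ boundedFrom b r
boundedFrom-map-suc b []      = refl
boundedFrom-map-suc b (x ∷ r) = cong₂ _∧_ (suc-≤ᵇ-suc x) (boundedFrom-map-suc (suc b) r)
  where
  suc-≤ᵇ-suc : ∀ x → (suc x ≤ᵇ suc b) ≡ (x ≤ᵇ b)
  suc-≤ᵇ-suc zero    = refl
  suc-≤ᵇ-suc (suc x) = refl

ones-≥2 : ∀ {l} → All (2 ≤_) l → ones l ≡ 0
ones-≥2 []                   = refl
ones-≥2 (s≤s (s≤s z≤n) ∷ ps) = ones-≥2 ps

map-suc-rest-≥2 : ∀ {l} → All (2 ≤_) l → map suc (rest l) ≡ l
map-suc-rest-≥2 []                   = refl
map-suc-rest-≥2 (s≤s (s≤s z≤n) ∷ ps) = cong (_ ∷_) (map-suc-rest-≥2 ps)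

boundedFrom-ones : ∀ a l → Sorted l → All (1 ≤_) l →
  boundedFrom (suc a) l ≡ boundedFrom (suc a + ones l) (map suc (rest l))
boundedFrom-ones a []                 _  _         = refl
boundedFrom-ones a (1 ∷ l)            l↗ (_ ∷ l≥1) =
  trans (boundedFrom-ones (suc a) l (Linked.tail l↗) l≥1)
        (cong (λ z → boundedFrom z (map suc (rest l))) (sym (+-suc (suc a) (ones l))))
boundedFrom-ones a l@(suc (suc _) ∷ _) l↗ _         = cong₂ boundedFrom
  (sym (trans (cong (suc a +_) (ones-≥2 l≥2)) (+-identityʳ (suc a)))) (sym (map-suc-rest-≥2 l≥2))
  where
  l≥2 : All (2 ≤_) l
  l≥2 = Linked⇒All ≤-trans (s≤s (s≤s z≤n)) l↗

rest-sorted : ∀ {l} → Sorted l → Sorted (rest l)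
rest-sorted l↗ = Sorted.map⁺ ≤-totalOrder ≤-totalOrder pred-mono-≤ (Sorted.filter⁺ ≤-totalOrder (∁? (_≟ 1)) l↗)

rest-inRange : ∀ {M l} → All (InRange (suc M)) l → All (InRange M) (rest l)
rest-inRange                        []                   = []
rest-inRange {l = 0 ∷ _}            ((() , _) ∷ _)
rest-inRange {l = 1 ∷ _}            (_ ∷ l∈)             = rest-inRange l∈
rest-inRange {l = suc (suc _) ∷ _}  ((_ , s≤s v≤M) ∷ l∈) = (s≤s z≤n , v≤M) ∷ rest-inRange l∈

mutual
  boundedFrom-parks : ∀ M a l → Sorted l → All (InRange M) l → boundedFrom (suc a) l ≡ parks M (suc a) l
  boundedFrom-parks zero    a []      _  _                  = refl
  boundedFrom-parks zero    a (_ ∷ _) _  ((1≤v , v≤0) ∷ _) = contradiction (≤-trans 1≤v v≤0) λ ()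
  boundedFrom-parks (suc M) a l       l↗ l∈                = begin
      boundedFrom (suc a) l
    ≡⟨ boundedFrom-ones a l l↗ (All.map proj₁ l∈) ⟩
      boundedFrom (suc a + ones l) (map suc (rest l))
    ≡⟨ boundedFrom-map-suc (a + ones l) (rest l) ⟩
      boundedFrom (a + ones l) (rest l)
    ≡⟨ boundedFrom-parksRest M (a + ones l) (rest l) (rest-sorted l↗) (rest-inRange l∈) ⟩
      parksRest M (suc a + ones l) (rest l)
    ∎
    where open ≡-Reasoning

  boundedFrom-parksRest : ∀ M s r → Sorted r → All (InRange M) r → boundedFrom s r ≡ parksRest M (suc s) r
  boundedFrom-parksRest M s       []          _  _              = refl
  boundedFrom-parksRest M zero    (zero ∷ _)  _  ((() , _) ∷ _)
  boundedFrom-parksRest M zero    (suc _ ∷ _) _  _              = refl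
  boundedFrom-parksRest M (suc s) r@(_ ∷ _)   r↗ r∈             = boundedFrom-parks M s r r↗ r∈

allB-positive : ∀ {M y} → All (InRange M) y → allB (1 ≤ᵇ_) y ≡ true
allB-positive []                  = refl
allB-positive ((s≤s z≤n , _) ∷ y∈) = allB-positive y∈

isPF-parks : ∀ M y → All (InRange M) y → isPF y ≡ parks M 1 y
isPF-parks M y y∈ = begin
    allB (1 ≤ᵇ_) y ∧ boundedFrom 1 (sortℕ y)
  ≡⟨ cong (_∧ boundedFrom 1 (sortℕ y)) (allB-positive y∈) ⟩
    boundedFrom 1 (sortℕ y)
  ≡⟨ boundedFrom-parks M 0 (sortℕ y) (sort-↗ y) (All-resp-↭ (↭-sym (sort-↭ y)) y∈) ⟩
    parks M 1 (sortℕ y)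
  ≡⟨ parks-↭ M 1 (sort-↭ y) ⟩
    parks M 1 y
  ∎
  where
  open ≡-Reasoning
  open SortingAlgorithm mergeSort using (sort-↗; sort-↭)

ones-removeAt : ∀ x i → lookup x i ≡ 1 → suc (ones (removeAt x i)) ≡ ones x
ones-removeAt (1 ∷ _)           zero    refl = refl
ones-removeAt (0 ∷ x)           (suc i) e    = ones-removeAt x i e
ones-removeAt (1 ∷ x)           (suc i) e    = cong suc (ones-removeAt x i e)
ones-removeAt (suc (suc _) ∷ x) (suc i) e    = ones-removeAt x i e

rest-removeAt : ∀ x i → lookup x i ≡ 1 → rest (removeAt x i) ≡ rest x
rest-removeAt (1 ∷ _)           zero    refl = refl
rest-removeAt (0 ∷ x)           (suc i) e    = cong (0 ∷_) (rest-removeAt x i e)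
rest-removeAt (1 ∷ x)           (suc i) e    = rest-removeAt x i e
rest-removeAt (suc (suc v) ∷ x) (suc i) e    = cong (suc v ∷_) (rest-removeAt x i e)

All-removeAt : ∀ {P : ℕ → Set} {x} i → All P x → All P (removeAt x i)
All-removeAt zero    (_ ∷ px) = px
All-removeAt (suc i) (p ∷ px) = p ∷ All-removeAt i px

allB-map : ∀ {B : Set} (p : B → Bool) (f : A → B) xs → allB p (map f xs) ≡ allB (p ∘ f) xs
allB-map p f []       = refl
allB-map p f (x ∷ xs) = cong (p (f x) ∧_) (allB-map p f xs)

allB-removeAt-ones : ∀ x (ψ : List ℕ → Bool) V → (∀ i → lookup x i ≡ 1 → ψ (removeAt x i) ≡ V) →
  allB (λ i → if lookup x i ≡ᵇ 1 then ψ (removeAt x i) else true) (allFin (length x)) ≡ (ones x ≡ᵇ 0) ∨ V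
allB-removeAt-ones []      ψ V _    = refl
allB-removeAt-ones (y ∷ x) ψ V ψ≡V =
  trans (cong ((if y ≡ᵇ 1 then ψ x else true) ∧_) (begin
      allB F (tabulate suc)
    ≡⟨ cong (allB F) (map-tabulate id suc) ⟨
      allB F (map suc (allFin (length x)))
    ≡⟨ allB-map F suc (allFin (length x)) ⟩
      allB (F ∘ suc) (allFin (length x))
    ≡⟨ allB-removeAt-ones x (ψ ∘ (y ∷_)) V (ψ≡V ∘ suc) ⟩
      (ones x ≡ᵇ 0) ∨ V
    ∎))
    (by-cases y (ψ≡V zero))
  where
  open ≡-Reasoning
  F : Fin (length (y ∷ x)) → Bool
  F i = if lookup (y ∷ x) i ≡ᵇ 1 then ψ (removeAt (y ∷ x) i) else true
  by-cases : ∀ y → (y ≡ 1 → ψ x ≡ V) →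
    (if y ≡ᵇ 1 then ψ x else true) ∧ ((ones x ≡ᵇ 0) ∨ V) ≡ (ones (y ∷ x) ≡ᵇ 0) ∨ V
  by-cases 0             _ = refl
  by-cases 1             h = trans (cong₂ (λ u v → u ∧ v) (h refl) (∨-comm (ones x ≡ᵇ 0) V)) (∧-abs-∨ V _)
  by-cases (suc (suc _)) _ = refl

∧-of-implied : ∀ a b → (b ≡ true → a ≡ true) → a ∧ b ≡ b
∧-of-implied a false _   = ∧-zeroʳ a
∧-of-implied a true  b⇒a = trans (∧-identityʳ a) (b⇒a refl)

parksRest-prime : ∀ M c r → parksRest M (suc c) r ∧ ((c ≡ᵇ 0) ∨ parksRest M c r) ≡ parksRest M c r
parksRest-prime M zero    r = ∧-identityʳ _
parksRest-prime M (suc c) r = ∧-of-implied _ _ (parksRest-mono M (suc c) r)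

isPPF-parks : ∀ n x → All (InRange (suc n)) x → isPPF x ≡ parks (suc n) 0 x
isPPF-parks n x x∈ =
  trans (cong₂ _∧_ (isPF-parks (suc n) x x∈) (allB-removeAt-ones x isPF (parksRest n (ones x) (rest x)) isPF-removeAt))
        (parksRest-prime n (ones x) (rest x))
  where
  isPF-removeAt : ∀ i → lookup x i ≡ 1 → isPF (removeAt x i) ≡ parksRest n (ones x) (rest x)
  isPF-removeAt i e = trans (isPF-parks (suc n) (removeAt x i) (All-removeAt i x∈))
                            (cong₂ (parksRest n) (ones-removeAt x i e) (rest-removeAt x i e))

-- Prime parking functions of length n + 1

seqs-inRange : ∀ m k → All (All (InRange m)) (seqs m k)
seqs-inRange m zero    = [] ∷ []
seqs-inRange m (suc k) = concat⁺ (All-map⁺ (All-map⁺ (applyUpTo⁺₁ id m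
  (λ i<m → All-map⁺ (All.map (λ x∈ → (s≤s z≤n , i<m) ∷ x∈) (seqs-inRange m k))))))

length-filter : ∀ (p : A → Bool) xs → length (filter (λ x → T? (p x)) xs) ≡ ∑[ x ← xs ] (1 when p x)
length-filter p []       = refl
length-filter p (x ∷ xs) with p x
... | true  = cong suc (length-filter p xs)
... | false = length-filter p xs

sum-map-filter : ∀ (w : A → ℕ) (p : A → Bool) xs →
  sum (map w (filter (λ x → T? (p x)) xs)) ≡ ∑[ x ← xs ] (w x when p x)
sum-map-filter w p []       = refl
sum-map-filter w p (x ∷ xs) with p x
... | true  = cong (w x +_) (sum-map-filter w p xs)
... | false = sum-map-filter w p xs

sumOver-isPPF : ∀ n (w : List ℕ → ℕ) →
  ∑[ x ← seqs (suc n) (suc n) ] (w x when isPPF x) ≡ sumParks w (suc n) 0 (suc n)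
sumOver-isPPF n w = sumOver-cong-local
  (All.map (λ {x} x∈ → cong (w x when_) (isPPF-parks n x x∈)) (seqs-inRange (suc n) (suc n)))

length-PPF : ∀ n .{{_ : NonZero n}} → length (map first (PPF (suc n))) ≡ n ^ n
length-PPF n = begin
    length (map first (PPF (suc n)))
  ≡⟨ length-map first (PPF (suc n)) ⟩
    length (PPF (suc n))
  ≡⟨ length-filter isPPF (seqs (suc n) (suc n)) ⟩
    ∑[ x ← seqs (suc n) (suc n) ] (1 when isPPF x)
  ≡⟨ sumOver-isPPF n (λ _ → 1) ⟩
    countParks (suc n) 0 (suc n)
  ≡⟨ countParks-prime n ⟩
    n ^ n
  ∎
  where open ≡-Reasoning

sum-first-PPF : ∀ n → sum (map first (PPF (suc n))) ≡ sumFirstParks (suc n) 0 (suc n)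
sum-first-PPF n = trans (sum-map-filter first isPPF (seqs (suc n) (suc n))) (sumOver-isPPF n first)

-- The mean as a rational number

open import Data.Integer using (ℤ; +_)
import Data.Integer as ℤ
import Data.Integer.Properties as ℤ
open import Data.Integer.Tactic.RingSolver as ℤ-Solver using ()
open import Data.Rational using (ℚ; _/_; ½; 0ℚ; 1ℚ; toℚᵘ) renaming (_+_ to _+ℚ_; _*_ to _*ℚ_; _-_ to _-ℚ_)
import Data.Rational.Properties as ℚ
open import Data.Rational.Solver using (module +-*-Solver)
open import Data.Rational.Unnormalised using (mkℚᵘ; *≡*) renaming (_/_ to _/ᵘ_; _≃_ to _≃ᵘ_)
import Data.Rational.Unnormalised.Properties as ℚᵘ

ι : ℕ → ℚ
ι k = (+ k) / 1

toℚᵘ-/ : ∀ (a : ℤ) b .{{_ : NonZero b}} → toℚᵘ (a / b) ≃ᵘ a /ᵘ b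
toℚᵘ-/ a (suc b) = ℚ.toℚᵘ-fromℚᵘ (mkℚᵘ a b)

ι-+ : ∀ a b → ι (a + b) ≡ ι a +ℚ ι b
ι-+ a b = ℚ.toℚᵘ-injective (ℚᵘ.≃-trans (toℚᵘ-/ (+ (a + b)) 1) (ℚᵘ.≃-trans (*≡* eq)
  (ℚᵘ.≃-sym (ℚᵘ.≃-trans (ℚ.toℚᵘ-homo-+ (ι a) (ι b)) (ℚᵘ.+-cong (toℚᵘ-/ (+ a) 1) (toℚᵘ-/ (+ b) 1))))))
  where
  eq : + (a + b) ℤ.* + 1 ≡ (+ a ℤ.* + 1 ℤ.+ + b ℤ.* + 1) ℤ.* + 1
  eq = trans (cong (ℤ._* + 1) (ℤ.pos-+ a b)) (distrib (+ a) (+ b))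
    where
    distrib : ∀ x y → (x ℤ.+ y) ℤ.* + 1 ≡ (x ℤ.* + 1 ℤ.+ y ℤ.* + 1) ℤ.* + 1
    distrib = ℤ-Solver.solve-∀

ι-* : ∀ a b → ι (a * b) ≡ ι a *ℚ ι b
ι-* a b = ℚ.toℚᵘ-injective (ℚᵘ.≃-trans (toℚᵘ-/ (+ (a * b)) 1) (ℚᵘ.≃-trans (*≡* eq)
  (ℚᵘ.≃-sym (ℚᵘ.≃-trans (ℚ.toℚᵘ-homo-* (ι a) (ι b)) (ℚᵘ.*-cong (toℚᵘ-/ (+ a) 1) (toℚᵘ-/ (+ b) 1))))))
  where
  eq : + (a * b) ℤ.* + 1 ≡ (+ a ℤ.* + b) ℤ.* + 1
  eq = cong (ℤ._* + 1) (ℤ.pos-* a b)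

ι-*-/ : ∀ a b .{{_ : NonZero b}} → ι b *ℚ ((+ a) / b) ≡ ι a
ι-*-/ a b@(suc b-1) = ℚ.toℚᵘ-injective (ℚᵘ.≃-trans (ℚ.toℚᵘ-homo-* (ι b) ((+ a) / b))
  (ℚᵘ.≃-trans (ℚᵘ.*-cong (toℚᵘ-/ (+ b) 1) (toℚᵘ-/ (+ a) b)) (ℚᵘ.≃-trans (*≡* eq) (ℚᵘ.≃-sym (toℚᵘ-/ (+ a) 1)))))
  where
  eq : (+ b ℤ.* + a) ℤ.* + 1 ≡ + a ℤ.* + suc (b-1 + 0)
  eq = trans (cong (λ z → (+ suc z ℤ.* + a) ℤ.* + 1) (sym (+-identityʳ b-1))) (comm (+ suc (b-1 + 0)) (+ a))
    where
    comm : ∀ x y → (x ℤ.* y) ℤ.* + 1 ≡ y ℤ.* x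
    comm = ℤ-Solver.solve-∀

*-cancelˡ-ι : ∀ N .{{_ : NonZero N}} {p q} → ι N *ℚ p ≡ ι N *ℚ q → p ≡ q
*-cancelˡ-ι N {p} {q} Np≡Nq = begin
    p                  ≡⟨ ℚ.*-identityˡ p ⟨
    1ℚ *ℚ p            ≡⟨ cong (_*ℚ p) u*N≡1 ⟨
    u *ℚ ι N *ℚ p      ≡⟨ ℚ.*-assoc u (ι N) p ⟩
    u *ℚ (ι N *ℚ p)    ≡⟨ cong (u *ℚ_) Np≡Nq ⟩
    u *ℚ (ι N *ℚ q)    ≡⟨ ℚ.*-assoc u (ι N) q ⟨
    u *ℚ ι N *ℚ q      ≡⟨ cong (_*ℚ q) u*N≡1 ⟩
    1ℚ *ℚ q            ≡⟨ ℚ.*-identityˡ q ⟩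
    q                  ∎
  where
  open ≡-Reasoning
  u : ℚ
  u = (+ 1) / N
  u*N≡1 : u *ℚ ι N ≡ 1ℚ
  u*N≡1 = trans (ℚ.*-comm u (ι N)) (ι-*-/ 1 N)

mean-formula : ∀ S N F Q k (P : ℚ) .{{_ : NonZero N}} → 2 * S + Q ≡ k * N → ι F *ℚ P ≡ ι Q →
  (+ S) / N ≡ ½ *ℚ ((+ k) / 1 -ℚ ((+ F) / N) *ℚ P)
mean-formula S N F Q k P 2S+Q≡kN FP≡Q = *-cancelˡ-ι N (begin
    ι N *ℚ ((+ S) / N)
  ≡⟨ ι-*-/ S N ⟩
    ι S
  ≡⟨ solve 2 (λ s q → s := con ½ :* ((con (ι 2) :* s :+ q) :- q)) refl (ι S) (ι Q) ⟩
    ½ *ℚ (ι 2 *ℚ ι S +ℚ ι Q -ℚ ι Q)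
  ≡⟨ cong (λ z → ½ *ℚ (z +ℚ ι Q -ℚ ι Q)) (ι-* 2 S) ⟨
    ½ *ℚ (ι (2 * S) +ℚ ι Q -ℚ ι Q)
  ≡⟨ cong (λ z → ½ *ℚ (z -ℚ ι Q)) (trans (sym (ι-+ (2 * S) Q)) (trans (cong ι 2S+Q≡kN) (ι-* k N))) ⟩
    ½ *ℚ (ι k *ℚ ι N -ℚ ι Q)
  ≡⟨ cong (λ z → ½ *ℚ (ι k *ℚ ι N -ℚ z)) (trans (sym FP≡Q) (cong (_*ℚ P) (sym (ι-*-/ F N)))) ⟩
    ½ *ℚ (ι k *ℚ ι N -ℚ ι N *ℚ ((+ F) / N) *ℚ P)
  ≡⟨ solve 5 (λ h kk n f p → h :* (kk :* n :- n :* f :* p) := n :* (h :* (kk :- f :* p))) refl ½ (ι k) (ι N) ((+ F) / N) P ⟩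
    ι N *ℚ (½ *ℚ (ι k -ℚ ((+ F) / N) *ℚ P))
  ∎)
  where
  open ≡-Reasoning
  open +-*-Solver

expSum : ℕ → ℕ → ℚ
expSum Y m = foldr _+ℚ_ 0ℚ (map (λ s → ((+ (Y ^ s)) / (s !)) {{s !≢0}}) (upTo (suc m)))

foldr-+ℚ-applyUpTo-suc : ∀ (f : ℕ → ℚ) (g : ℕ → ℕ) k →
  foldr _+ℚ_ 0ℚ (map f (applyUpTo g (suc k))) ≡ foldr _+ℚ_ 0ℚ (map f (applyUpTo g k)) +ℚ f (g k)
foldr-+ℚ-applyUpTo-suc f g zero    = trans (ℚ.+-identityʳ (f (g 0))) (sym (ℚ.+-identityˡ (f (g 0))))
foldr-+ℚ-applyUpTo-suc f g (suc k) =
  trans (cong (f (g 0) +ℚ_) (foldr-+ℚ-applyUpTo-suc f (g ∘ suc) k)) (sym (ℚ.+-assoc (f (g 0)) _ _))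

truncExp-ℚ : ∀ m Y → ι (truncExp m Y) ≡ ι (m !) *ℚ expSum Y m
truncExp-ℚ zero    Y = refl
truncExp-ℚ (suc m) Y = begin
    ι (truncExp (suc m) Y)
  ≡⟨ cong ι (truncExp-pred (suc m) Y) ⟩
    ι (Y ^ suc m + suc m * truncExp m Y)
  ≡⟨ ι-+ (Y ^ suc m) (suc m * truncExp m Y) ⟩
    ι (Y ^ suc m) +ℚ ι (suc m * truncExp m Y)
  ≡⟨ cong (ι (Y ^ suc m) +ℚ_) (trans (ι-* (suc m) (truncExp m Y)) (cong (ι (suc m) *ℚ_) (truncExp-ℚ m Y))) ⟩
    ι (Y ^ suc m) +ℚ ι (suc m) *ℚ (ι (m !) *ℚ expSum Y m)
  ≡⟨ solve 4 (λ a b c p → a :+ b :* (c :* p) := b :* c :* p :+ a) refl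
             (ι (Y ^ suc m)) (ι (suc m)) (ι (m !)) (expSum Y m) ⟩
    ι (suc m) *ℚ ι (m !) *ℚ expSum Y m +ℚ ι (Y ^ suc m)
  ≡⟨ cong₂ _+ℚ_ (cong (_*ℚ expSum Y m) (sym (ι-* (suc m) (m !))))
                (sym (ι-*-/ (Y ^ suc m) (suc m !) {{suc m !≢0}})) ⟩
    ι (suc m !) *ℚ expSum Y m +ℚ ι (suc m !) *ℚ term (suc m)
  ≡⟨ ℚ.*-distribˡ-+ (ι (suc m !)) (expSum Y m) (term (suc m)) ⟨
    ι (suc m !) *ℚ (expSum Y m +ℚ term (suc m))
  ≡⟨ cong (ι (suc m !) *ℚ_) (foldr-+ℚ-applyUpTo-suc term id (suc m)) ⟨
    ι (suc m !) *ℚ expSum Y (suc m)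
  ∎
  where
  open ≡-Reasoning
  open +-*-Solver
  term : ℕ → ℚ
  term s = ((+ (Y ^ s)) / (s !)) {{s !≢0}}

mean-of-length : ∀ l N .{{_ : NonZero N}} → length l ≡ N → mean l ≡ (+ sum l) / N
mean-of-length []      N ∣l∣≡N = contradiction (sym ∣l∣≡N) (≢-nonZero⁻¹ N)
mean-of-length l@(_ ∷ _) N ∣l∣≡N = ℚ./-cong {p₁ = + sum l} refl ∣l∣≡N

theorem1p1 : (n : ℕ) → expectedFirstPPF n ≡ rhs n
theorem1p1 zero      = refl
theorem1p1 n@(suc _) = begin
    mean (map first (PPF (suc n)))
  ≡⟨ mean-of-length (map first (PPF (suc n))) (n ^ n) (length-PPF n) ⟩
    (+ sum (map first (PPF (suc n)))) / (n ^ n)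
  ≡⟨ cong (λ s → (+ s) / (n ^ n)) (sum-first-PPF n) ⟩
    (+ sumFirstParks (suc n) 0 (suc n)) / (n ^ n)
  ≡⟨ mean-formula (sumFirstParks (suc n) 0 (suc n)) (n ^ n) (n !) (truncExp n n) (n + 3) (partialExp n)
                  (sumFirstParks-prime n) (sym (truncExp-ℚ n n)) ⟩
    rhs n
  ∎
  where
  open ≡-Reasoning
  instance
    nⁿ≢0-n : NonZero (n ^ n)
    nⁿ≢0-n = nⁿ≢0 n
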